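{- Let $m\ge 3$, $r \ge 1$ be integers. Then $\operatorname{Z}(Wb(m,r)) \ge \max\left\{\left\lceil \tfrac{m}{2}\right\rceil, \min\{m,2r\}\right\}$.
   Context: The web graph $Wb(m,r)$ is obtained from the Cartesian product $C_m \Box P_r$, with vertices $v_{i,j}$ ($i\in[m]$, $j\in[r]$), where $v_{i,j_1}\sim v_{i,j_2}$ iff $|j_1-j_2|=1$ and $v_{i_1,j}\sim v_{i_2,j}$ iff $|i_1-i_2|=1$ or $\{i_1,i_2\}=\{1,m\}$, by adding pendant vertices $p_1,\dots,p_m$ with $p_i$ adjacent only to $v_{i,1}$. Zero forcing: a blue vertex with exactly one white neighbor may color that neighbor blue; a zero forcing set is an initial blue set from which repeated application colors all vertices blue; $\operatorname{Z}(G)$ is the minimum size of a zero forcing set. -}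

module Defs where

open import Level using (0ℓ)
open import Data.Nat using (ℕ; zero; suc; _∸_; _≤_)
open import Data.Fin using (Fin; toℕ)
open import Data.Product using (_×_; _,_)
open import Data.Sum using (_⊎_)
open import Data.List using (List; length)
open import Data.List.Membership.Propositional using (_∈_)
open import Data.List.Relation.Unary.Unique.Propositional using (Unique)
open import Relation.Binary.PropositionalEquality using (_≡_; _≢_)

record Graph : Set₁ where
  field
    V   : Set
    _~_ : V → V → Set

open Graph public

-- A blue vertex u with a neighbour v all of whose other neighbours are blue
-- forces v.  (The final coloured set of the forcing process is exactly this
-- inductively generated set, independently of the order of forces.)
data Blue (G : Graph) (S : List (V G)) : V G → Set where
  initial : ∀ {v} → v ∈ S → Blue G S v
  force   : ∀ {u v} → Blue G S u → _~_ G u v →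
            (∀ w → _~_ G u w → w ≢ v → Blue G S w) →
            Blue G S v

ZeroForcingSet : (G : Graph) → List (V G) → Set
ZeroForcingSet G S = ∀ v → Blue G S v

-- Z(G) ≥ k : every zero forcing set (a finite set of vertices, given as a
-- duplicate-free list) has at least k elements.  (Z(G) is the minimum size.)
ZAtLeast : Graph → ℕ → Set
ZAtLeast G k = ∀ (S : List (V G)) → Unique S → ZeroForcingSet G S → k ≤ length S

-- Vertices of Wb(m,r): grid vertices v_{i,j} and pendants p_i (0-indexed).
data WbV (m r : ℕ) : Set where
  grid : Fin m → Fin r → WbV m r
  pend : Fin m → WbV m r

CycAdj : (m : ℕ) → Fin m → Fin m → Set
CycAdj m i₁ i₂ =
  toℕ i₂ ≡ suc (toℕ i₁) ⊎ toℕ i₁ ≡ suc (toℕ i₂) ⊎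
  (toℕ i₁ ≡ 0 × toℕ i₂ ≡ m ∸ 1) ⊎ (toℕ i₂ ≡ 0 × toℕ i₁ ≡ m ∸ 1)

PathAdj : (r : ℕ) → Fin r → Fin r → Set
PathAdj r j₁ j₂ = toℕ j₂ ≡ suc (toℕ j₁) ⊎ toℕ j₁ ≡ suc (toℕ j₂)

data WbAdj (m r : ℕ) : WbV m r → WbV m r → Set where
  along  : ∀ {i j₁ j₂} → PathAdj r j₁ j₂ → WbAdj m r (grid i j₁) (grid i j₂)
  around : ∀ {i₁ i₂ j} → CycAdj m i₁ i₂ → WbAdj m r (grid i₁ j) (grid i₂ j)
  pendL  : ∀ {i} {j : Fin r} → toℕ j ≡ 0 → WbAdj m r (pend i) (grid i j)
  pendR  : ∀ {i} {j : Fin r} → toℕ j ≡ 0 → WbAdj m r (grid i j) (pend i)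

Wb : ℕ → ℕ → Graph
Wb m r = record { V = WbV m r ; _~_ = WbAdj m r }

{-# OPTIONS --safe #-}

-- Run the forcing process one force at a time. At every stage the blue vertices that have not forced
-- yet (idle vertices) are the current ends of the forcing chains, so there are exactly |S| of them.
-- A pendant outside S never forces, because its only neighbour forced it; at the end every pendant
-- outside S is idle, so m ≤ |S| + |S|.
-- For min{m, 2r}, keep the invariant that every ring has two non-forcers and some ring e has no
-- forcer. If it survives to the end, ring e consists of m idle vertices. If every ring acquires a
-- forcer, each ring has two non-forcers next to a forcer of the ring, and these are idle: 2r in all.
-- If after some force a ring j has at most one non-forcer, then ring e still has no forcer and every
-- column contains an idle vertex: a non-forcer next to a forcer on the path from ring j to ring e, or
-- the remaining non-forcer of ring j. This gives m.

module Submission where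

open import Defs
open import Data.Nat using (ℕ; _≤_; _⊔_; _⊓_; _*_; ⌈_/2⌉)
open import Data.Nat as ℕ using (zero; suc; _+_; _<_; z≤n; s≤s; s≤s⁻¹)
open import Data.Nat.Properties
  using (≤-refl; ≤-trans; <-trans; <-≤-trans; ≤-<-trans; m<n⇒m<1+n; +-suc; +-identityʳ; +-cancelʳ-≤;
         m≤n+m; <⇒≱; +-monoˡ-≤; ⊔-lub; m⊓n≤m; m⊓n≤n; ⌈n/2⌉-mono; n≡⌈n+n/2⌉; module ≤-Reasoning)
  renaming (≤∧≢⇒< to ℕ-≤∧≢⇒<)
open import Data.Fin as Fin using (Fin; zero; suc; toℕ; fromℕ; fromℕ<)
open import Data.Fin.Properties
  using (toℕ-injective; toℕ-fromℕ; toℕ-fromℕ<; toℕ<n; ≤fromℕ; ≤∧≢⇒<; <⇒≢; <-cmp; any?; all?; ¬∀⟶∃¬)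
  renaming (_≟_ to _≟ᶠ_)
open import Data.List using (List; []; _∷_; length; _++_; map; filter; tabulate; allFin; cartesianProductWith)
open import Data.List.Properties using (length-++; length-map; length-tabulate; length-removeAt′)
import Data.List.Relation.Unary.All as All
open import Data.List.Relation.Unary.All.Properties using (¬All⇒Any¬)
open import Data.List.Relation.Unary.Any as Any using (here; there; _─_)
open import Data.List.Relation.Unary.AllPairs using ([]; _∷_)
open import Data.List.Membership.Propositional using (_∈_; _∉_; lose)
open import Data.List.Membership.Propositional.Properties
  using (∈-++⁺ˡ; ∈-++⁺ʳ; ∈-++⁻; ∈-map⁺; ∈-map⁻; ∈-tabulate⁻; ∈-allFin; ∈-filter⁺; ∈-filter⁻;
         ∈-cartesianProductWith⁺)
open import Data.List.Relation.Binary.Subset.Propositional using (_⊆_)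
open import Data.List.Relation.Unary.Unique.Propositional using (Unique)
import Data.List.Relation.Unary.Unique.Propositional.Properties as Unique
open import Data.Product using (∃; ∃₂; _×_; _,_; proj₁; proj₂)
open import Data.Sum as Sum using (_⊎_; inj₁; inj₂; [_,_]′)
open import Function using (_∘_; flip)
open import Level using (0ℓ)
open import Relation.Nullary using (Dec; yes; no; ¬_; contradiction)
open import Relation.Nullary.Decidable using (_×-dec_; _⊎-dec_; ¬?; map′; decidable-stable)
open import Relation.Unary using (Pred; Decidable)
open import Relation.Unary.Properties using (∁?)
open import Relation.Binary using (DecidableEquality)
import Relation.Binary as B
open import Relation.Binary.Definitions using (tri<; tri≈; tri>)
open import Relation.Binary.PropositionalEquality
  using (_≡_; _≢_; refl; sym; trans; cong; cong₂; subst; ≢-sym; module ≡-Reasoning)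

∈-─ : ∀ {A : Set} {x z : A} {xs} (x∈xs : x ∈ xs) → z ∈ xs → z ≢ x → z ∈ (xs ─ x∈xs)
∈-─ (here refl)  (here refl)  z≢x = contradiction refl z≢x
∈-─ (here _)     (there z∈xs) _   = z∈xs
∈-─ (there _)    (here refl)  _   = here refl
∈-─ (there x∈xs) (there z∈xs) z≢x = there (∈-─ x∈xs z∈xs z≢x)

unique⊆⇒length≤ : ∀ {A : Set} {xs ys : List A} → Unique xs → xs ⊆ ys → length xs ≤ length ys
unique⊆⇒length≤ {xs = []} _ _ = z≤n
unique⊆⇒length≤ {xs = x ∷ xs} {ys} (x∉xs ∷ xs-unique) x∷xs⊆ys = begin
  suc (length xs)          ≤⟨ s≤s (unique⊆⇒length≤ xs-unique xs⊆ys─x) ⟩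
  suc (length (ys ─ x∈ys)) ≡⟨ length-removeAt′ ys _ ⟨
  length ys                ∎
  where
  open ≤-Reasoning
  x∈ys = x∷xs⊆ys (here refl)
  xs⊆ys─x : xs ⊆ (ys ─ x∈ys)
  xs⊆ys─x z∈xs = ∈-─ x∈ys (x∷xs⊆ys (there z∈xs)) (≢-sym (All.lookup x∉xs z∈xs))

-- Boundaries of subsets of paths and cycles

Boundary : ∀ {n} → B.Rel (Fin n) 0ℓ → Pred (Fin n) 0ℓ → Pred (Fin n) 0ℓ
Boundary _∼_ A k = ¬ A k × ∃ λ i → A i × i ∼ k

Boundary-mono : ∀ {n} {R R′ : B.Rel (Fin n) 0ℓ} {A k} → R B.⇒ R′ → Boundary R A k → Boundary R′ A k
Boundary-mono R⇒R′ (¬Ak , i , Ai , iRk) = ¬Ak , i , Ai , R⇒R′ iRk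

Successor : ∀ {n} → B.Rel (Fin n) 0ℓ
Successor i k = toℕ k ≡ suc (toℕ i)

crossing : ∀ {P : Pred ℕ 0ℓ} → Decidable P → ∀ {a b} → a < b → P a → ¬ P b →
           ∃ λ k → a ≤ k × k < b × P k × ¬ P (suc k)
crossing {P} P? {a} {suc b} a<1+b Pa ¬Pb with P? b
... | yes Pb = b , s≤s⁻¹ a<1+b , ≤-refl , Pb , ¬Pb
... | no ¬Pb′ with crossing P? (ℕ-≤∧≢⇒< (s≤s⁻¹ a<1+b) λ { refl → ¬Pb′ Pa }) Pa ¬Pb′
...   | k , a≤k , k<b , Pk , ¬P1+k = k , a≤k , m<n⇒m<1+n k<b , Pk , ¬P1+k

boundary-above : ∀ {n} {A : Pred (Fin n) 0ℓ} → Decidable A → ∀ {a b} → A a → ¬ A b → a Fin.< b →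
                 ∃ λ k → a Fin.< k × k Fin.≤ b × Boundary Successor A k
boundary-above {A = A} A? {a} {b} Aa ¬Ab a<b with crossing A↑? a<b (a , refl , Aa) ¬A↑b
  where
  A↑ : Pred ℕ 0ℓ
  A↑ k = ∃ λ i → toℕ i ≡ k × A i
  A↑? : Decidable A↑
  A↑? k = any? λ i → (toℕ i ℕ.≟ k) ×-dec A? i
  ¬A↑b : ¬ A↑ (toℕ b)
  ¬A↑b (i , i≡b , Ai) = ¬Ab (subst A (toℕ-injective i≡b) Ai)
... | _ , a≤i , i<b , (i , refl , Ai) , ¬A↑1+i = k , a<k , k≤b , ¬Ak , i , Ai , k≡1+i
  where
  1+i<n = ≤-<-trans i<b (toℕ<n b)
  k = fromℕ< 1+i<n
  k≡1+i = toℕ-fromℕ< 1+i<n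
  a<k = subst (toℕ a <_) (sym k≡1+i) (s≤s a≤i)
  k≤b = subst (_≤ toℕ b) (sym k≡1+i) i<b
  ¬Ak : ¬ A k
  ¬Ak Ak = ¬A↑1+i (k , k≡1+i , Ak)

boundary-below : ∀ {n} {A : Pred (Fin n) 0ℓ} → Decidable A → ∀ {a b} → A a → ¬ A b → b Fin.< a →
                 ∃ λ k → b Fin.≤ k × k Fin.< a × Boundary (flip Successor) A k
boundary-below A? {a} {b} Aa ¬Ab b<a with boundary-above (∁? A?) ¬Ab (λ ¬Aa → ¬Aa Aa) b<a
... | i , b<i , i≤a , ¬¬Ai , k , ¬Ak , i≡1+k =
  k , s≤s⁻¹ (subst (toℕ b <_) i≡1+k b<i) , subst (_≤ toℕ a) i≡1+k i≤a ,
  ¬Ak , i , decidable-stable (A? i) ¬¬Ai , i≡1+k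

path-boundary : ∀ {n} {A : Pred (Fin n) 0ℓ} → Decidable A → ∀ {a b} → A a → ¬ A b →
                ∃ (Boundary (PathAdj n) A)
path-boundary A? {a} {b} Aa ¬Ab with <-cmp a b
... | tri< a<b _ _ = let k , _ , _ , bd = boundary-above A? Aa ¬Ab a<b
                     in k , Boundary-mono {R′ = PathAdj _} inj₁ bd
... | tri≈ _ refl _ = contradiction Aa ¬Ab
... | tri> _ _ b<a = let k , _ , _ , bd = boundary-below A? Aa ¬Ab b<a
                     in k , Boundary-mono {R′ = PathAdj _} inj₂ bd

cycle-boundaries : ∀ {n} {A : Pred (Fin n) 0ℓ} → Decidable A → ∀ {x c₁ c₂} →
                   A x → ¬ A c₁ → ¬ A c₂ → c₁ ≢ c₂ →
                   ∃₂ λ b₁ b₂ → b₁ ≢ b₂ × Boundary (CycAdj n) A b₁ × Boundary (CycAdj n) A b₂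
cycle-boundaries {suc n} {A} A? {x} {c₁} {c₂} Ax ¬Ac₁ ¬Ac₂ c₁≢c₂ =
  strict⇒distinct (ends (A? first) (A? last))
  where
  strict⇒distinct : ∀ {P : Pred (Fin (suc n)) 0ℓ} → (∃₂ λ b₁ b₂ → b₁ Fin.< b₂ × P b₁ × P b₂) →
                    ∃₂ λ b₁ b₂ → b₁ ≢ b₂ × P b₁ × P b₂
  strict⇒distinct (b₁ , b₂ , b₁<b₂ , Pb₁ , Pb₂) = b₁ , b₂ , <⇒≢ b₁<b₂ , Pb₁ , Pb₂
  first last : Fin (suc n)
  first = zero
  last = fromℕ n
  first∼last : CycAdj (suc n) first last
  first∼last = inj₂ (inj₂ (inj₁ (refl , toℕ-fromℕ n)))
  last∼first : CycAdj (suc n) last first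
  last∼first = inj₂ (inj₂ (inj₂ (refl , toℕ-fromℕ n)))

  Bd = Boundary (CycAdj (suc n)) A

  up : ∀ {k} → Boundary Successor A k → Bd k
  up = Boundary-mono {R′ = CycAdj (suc n)} inj₁
  down : ∀ {k} → Boundary (flip Successor) A k → Bd k
  down = Boundary-mono {R′ = CycAdj (suc n)} (inj₂ ∘ inj₁)

  separate : ∀ {a c} → A a → ¬ A c → a ≢ c
  separate Aa ¬Ac refl = ¬Ac Aa
  above-first : ∀ {c : Fin (suc n)} → first ≢ c → first Fin.< c
  above-first = ≤∧≢⇒< z≤n
  below-last : ∀ {c : Fin (suc n)} → c ≢ last → c Fin.< last
  below-last = ≤∧≢⇒< (≤fromℕ _)

  avoiding : ∀ d → ∃ λ c → ¬ A c × c ≢ d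
  avoiding d with c₁ ≟ᶠ d
  ... | yes refl = c₂ , ¬Ac₂ , c₁≢c₂ ∘ sym
  ... | no c₁≢d = c₁ , ¬Ac₁ , c₁≢d

  between : ∀ {lo hi} → A first → A last → lo Fin.< hi → ¬ A lo → ¬ A hi →
            ∃₂ λ b₁ b₂ → b₁ Fin.< b₂ × Bd b₁ × Bd b₂
  between A₀ Aₙ lo<hi ¬Alo ¬Ahi =
    let k₁ , _ , k₁≤lo , bd₁ = boundary-above A? A₀ ¬Alo (above-first (separate A₀ ¬Alo))
        k₂ , hi≤k₂ , _ , bd₂ = boundary-below A? Aₙ ¬Ahi (below-last (≢-sym (separate Aₙ ¬Ahi)))
    in k₁ , k₂ , ≤-<-trans k₁≤lo (<-≤-trans lo<hi hi≤k₂) , up bd₁ , down bd₂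

  -- In every case the two boundary vertices lie on either side of some vertex, hence are distinct.
  ends : Dec (A first) → Dec (A last) → ∃₂ λ b₁ b₂ → b₁ Fin.< b₂ × Bd b₁ × Bd b₂
  ends (yes A₀) (no ¬Aₙ) =
    let c , ¬Ac , c≢last = avoiding last
        k , _ , k≤c , bd = boundary-above A? A₀ ¬Ac (above-first (separate A₀ ¬Ac))
    in k , last , ≤-<-trans k≤c (below-last c≢last) , up bd , (¬Aₙ , first , A₀ , first∼last)
  ends (no ¬A₀) (yes Aₙ) =
    let c , ¬Ac , c≢first = avoiding first
        k , c≤k , _ , bd = boundary-below A? Aₙ ¬Ac (below-last (≢-sym (separate Aₙ ¬Ac)))
    in first , k , <-≤-trans (above-first (≢-sym c≢first)) c≤k , (¬A₀ , last , Aₙ , last∼first) , down bd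
  ends (yes A₀) (yes Aₙ) with <-cmp c₁ c₂
  ... | tri< c₁<c₂ _ _ = between A₀ Aₙ c₁<c₂ ¬Ac₁ ¬Ac₂
  ... | tri≈ _ c₁≡c₂ _ = contradiction c₁≡c₂ c₁≢c₂
  ... | tri> _ _ c₂<c₁ = between A₀ Aₙ c₂<c₁ ¬Ac₂ ¬Ac₁
  ends (no ¬A₀) (no ¬Aₙ) =
    let k₁ , _ , k₁<x , bd₁ = boundary-below A? Ax ¬A₀ (above-first (≢-sym (separate Ax ¬A₀)))
        k₂ , x<k₂ , _ , bd₂ = boundary-above A? Ax ¬Aₙ (below-last (separate Ax ¬Aₙ))
    in k₁ , k₂ , <-trans k₁<x x<k₂ , down bd₁ , up bd₂

-- Zero forcing as a sequence of forces

module ZeroForcing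
  (G : Graph)
  (_≟_ : DecidableEquality (V G))
  (_∼?_ : B.Decidable (_~_ G))
  (vertices : List (V G))
  (∈-vertices : ∀ v → v ∈ vertices)
  where

  open import Data.List.Membership.DecPropositional _≟_ using (_∈?_)

  private
    Vertex = V G
    _∼_ = _~_ G

  record Force (B : List Vertex) : Set where
    field
      forcer target : Vertex
      forcer-blue   : forcer ∈ B
      target-white  : target ∉ B
      forcer∼target : forcer ∼ target
      others-blue   : ∀ w → forcer ∼ w → w ≢ target → w ∈ B

  white-or-complete : (B : List Vertex) → (∃ λ v → v ∉ B) ⊎ (∀ v → v ∈ B)
  white-or-complete B with All.all? (_∈? B) vertices
  ... | yes all-blue = inj₂ λ v → All.lookup all-blue (∈-vertices v)
  ... | no ¬all-blue = inj₁ (Any.satisfied (¬All⇒Any¬ (_∈? B) vertices ¬all-blue))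

  force-available : ∀ {S B v} → S ⊆ B → Blue G S v → v ∉ B → Force B
  force-available S⊆B (initial v∈S) v∉B = contradiction (S⊆B v∈S) v∉B
  force-available {B = B} S⊆B (force {u} {v} u-blue u∼v others) v∉B with u ∈? B
  ... | no u∉B = force-available S⊆B u-blue u∉B
  ... | yes u∈B with Any.any? (λ w → (u ∼? w) ×-dec (¬? (w ≟ v) ×-dec ¬? (w ∈? B))) vertices
  ...   | yes white-neighbour with Any.satisfied white-neighbour
  ...     | w , u∼w , w≢v , w∉B = force-available S⊆B (others w u∼w w≢v) w∉B
  force-available {B = B} S⊆B (force {u} {v} u-blue u∼v others) v∉B
    | yes u∈B | no no-white-neighbour = record
    { forcer = u ; target = v ; forcer-blue = u∈B ; target-white = v∉B ; forcer∼target = u∼v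
    ; others-blue = λ w u∼w w≢v → decidable-stable (w ∈? B) λ w∉B →
        no-white-neighbour (lose (∈-vertices w) (u∼w , w≢v , w∉B))
    }

  -- active lists the vertices that have forced so far.
  record State (S : List Vertex) : Set where
    field
      blue active      : List Vertex
      blue-unique      : Unique blue
      active-unique    : Unique active
      seed⊆blue        : S ⊆ blue
      active⊆blue      : active ⊆ blue
      active-closed    : ∀ {u w} → u ∈ active → u ∼ w → w ∈ blue
      forced-by-active : ∀ {v} → v ∈ blue → v ∉ S → ∃ λ u → u ∈ active × u ∼ v
      size             : length blue ≡ length S + length active

  open State public

  start : ∀ {S} → Unique S → State S
  start {S} S-unique = record
    { blue = S ; active = [] ; blue-unique = S-unique ; active-unique = []
    ; seed⊆blue = λ v∈S → v∈S ; active⊆blue = λ () ; active-closed = λ ()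
    ; forced-by-active = λ v∈S v∉S → contradiction v∈S v∉S
    ; size = sym (+-identityʳ (length S))
    }

  step : ∀ {S} (s : State S) → Force (blue s) → State S
  step {S} s F = record
    { blue = target ∷ blue s
    ; active = forcer ∷ active s
    ; blue-unique = All.tabulate (λ { v∈B refl → target-white v∈B }) ∷ blue-unique s
    ; active-unique =
        All.tabulate (λ { u∈A refl → target-white (active-closed s u∈A forcer∼target) }) ∷ active-unique s
    ; seed⊆blue = there ∘ seed⊆blue s
    ; active⊆blue = λ { (here refl) → there forcer-blue ; (there u∈A) → there (active⊆blue s u∈A) }
    ; active-closed = closed
    ; forced-by-active = λ { (here refl) _ → forcer , here refl , forcer∼target
                           ; (there v∈B) v∉S → let u , u∈A , u∼v = forced-by-active s v∈B v∉S
                                                in u , there u∈A , u∼v }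
    ; size = trans (cong suc (size s)) (sym (+-suc (length S) (length (active s))))
    }
    where
    open Force F
    closed : ∀ {u w} → u ∈ forcer ∷ active s → u ∼ w → w ∈ target ∷ blue s
    closed (there u∈A) u∼w = there (active-closed s u∈A u∼w)
    closed {w = w} (here refl) u∼w with w ≟ target
    ... | yes refl = here refl
    ... | no w≢target = there (others-blue w u∼w w≢target)

  Idle : ∀ {S} → State S → Pred Vertex 0ℓ
  Idle s v = v ∈ blue s × v ∉ active s

  -- The idle vertices are the current ends of the forcing chains, one chain for each vertex of S.
  idle-bound : ∀ {S L} (s : State S) → Unique L → (∀ {v} → v ∈ L → Idle s v) → length L ≤ length S
  idle-bound {S} {L} s L-unique L-idle = +-cancelʳ-≤ (length (active s)) (length L) (length S) (begin
    length L + length (active s)  ≡⟨ length-++ L ⟨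
    length (L ++ active s)        ≤⟨ unique⊆⇒length≤ (Unique.++⁺ L-unique (active-unique s) disjoint) L++A⊆B ⟩
    length (blue s)               ≡⟨ size s ⟩
    length S + length (active s)  ∎)
    where
    open ≤-Reasoning
    disjoint : ∀ {v} → ¬ (v ∈ L × v ∈ active s)
    disjoint (v∈L , v∈A) = proj₂ (L-idle v∈L) v∈A
    L++A⊆B : L ++ active s ⊆ blue s
    L++A⊆B v∈L++A with ∈-++⁻ L v∈L++A
    ... | inj₁ v∈L = proj₁ (L-idle v∈L)
    ... | inj₂ v∈A = active⊆blue s v∈A

  idle-family-bound : ∀ {S k} (s : State S) (f : Fin k → Vertex) → (∀ {i j} → f i ≡ f j → i ≡ j) →
                      (∀ i → Idle s (f i)) → k ≤ length S
  idle-family-bound s f f-injective f-idle =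
    subst (_≤ _) (length-tabulate f) (idle-bound s (Unique.tabulate⁺ f-injective) idle)
    where
    idle : ∀ {v} → v ∈ tabulate f → Idle s v
    idle v∈f = let i , v≡fi = ∈-tabulate⁻ v∈f in subst (Idle s) (sym v≡fi) (f-idle i)

  forcing-induction : ∀ {S} → ZeroForcingSet G S → (S-unique : Unique S) →
                      (P : State S → Set) {Q : Set} →
                      (∀ s → P s → (∀ v → v ∈ blue s) → Q) →
                      (∀ s → P s → (F : Force (blue s)) → P (step s F) ⊎ Q) →
                      P (start S-unique) → Q
  forcing-induction {S} zfs S-unique P {Q} done advance =
    run (suc (length vertices)) (start S-unique) (m≤n+m _ _)
    where
    run : (fuel : ℕ) (s : State S) → length vertices < length (blue s) + fuel → P s → Q
    run zero s enough _ = contradiction (unique⊆⇒length≤ (blue-unique s) (λ {v} _ → ∈-vertices v))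
                                        (<⇒≱ (subst (length vertices <_) (+-identityʳ _) enough))
    run (suc fuel) s enough Ps with white-or-complete (blue s)
    ... | inj₂ complete = done s Ps complete
    ... | inj₁ (v , v∉B) = continue (force-available (seed⊆blue s) (zfs v) v∉B)
      where
      continue : Force (blue s) → Q
      continue F with advance s Ps F
      ... | inj₁ P-next = run fuel (step s F) (subst (length vertices <_) (+-suc _ fuel) enough) P-next
      ... | inj₂ q = q

  Pendant : Pred Vertex 0ℓ
  Pendant v = ∀ {u w} → u ∼ v → v ∼ w → u ≡ w

  -- A forcer outside S was forced by an active, hence blue, neighbour, which is not its white target.
  pendant-forcer∈seed : ∀ {S} (s : State S) (F : Force (blue s)) →
                        Pendant (Force.forcer F) → Force.forcer F ∈ S
  pendant-forcer∈seed {S} s F pendant = decidable-stable (forcer ∈? S) λ forcer∉S →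
    let u , u∈A , u∼forcer = forced-by-active s forcer-blue forcer∉S
    in target-white (subst (_∈ blue s) (pendant u∼forcer forcer∼target) (active⊆blue s u∈A))
    where open Force F

  pendants-bound : ∀ {S L} → ZeroForcingSet G S → Unique S → Unique L → (∀ {v} → v ∈ L → Pendant v) →
                   length L ≤ length S + length S
  pendants-bound {S} {L} zfs S-unique L-unique L-pendant =
    forcing-induction zfs S-unique Pendants-active⊆S complete
                      (λ s invariant F → inj₁ (extend s invariant F)) λ ()
    where
    Pendants-active⊆S : State S → Set
    Pendants-active⊆S s = ∀ {v} → v ∈ active s → Pendant v → v ∈ S

    extend : ∀ s → Pendants-active⊆S s → (F : Force (blue s)) → Pendants-active⊆S (step s F)
    extend s _ F (here refl) = pendant-forcer∈seed s F
    extend s invariant F (there v∈A) = invariant v∈A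

    L∖S = filter (λ v → ¬? (v ∈? S)) L

    L⊆L∖S++S : L ⊆ L∖S ++ S
    L⊆L∖S++S {v} v∈L with v ∈? S
    ... | yes v∈S = ∈-++⁺ʳ L∖S v∈S
    ... | no v∉S = ∈-++⁺ˡ (∈-filter⁺ (λ v → ¬? (v ∈? S)) v∈L v∉S)

    complete : ∀ s → Pendants-active⊆S s → (∀ v → v ∈ blue s) → length L ≤ length S + length S
    complete s invariant all-blue = begin
      length L               ≤⟨ unique⊆⇒length≤ L-unique L⊆L∖S++S ⟩
      length (L∖S ++ S)      ≡⟨ length-++ L∖S ⟩
      length L∖S + length S  ≤⟨ +-monoˡ-≤ (length S) (idle-bound s (Unique.filter⁺ _ L-unique) idle) ⟩
      length S + length S    ∎
      where
      open ≤-Reasoning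
      idle : ∀ {v} → v ∈ L∖S → Idle s v
      idle {v} v∈L∖S = let v∈L , v∉S = ∈-filter⁻ (λ v → ¬? (v ∈? S)) {xs = L} v∈L∖S
                       in all-blue v , λ v∈A → v∉S (invariant v∈A (L-pendant v∈L))

-- The web graph

grid-injective : ∀ {m r} {i i′ : Fin m} {j j′ : Fin r} → grid {m} {r} i j ≡ grid i′ j′ → i ≡ i′ × j ≡ j′
grid-injective refl = refl , refl

pend-injective : ∀ {m r} {i i′ : Fin m} → pend {m} {r} i ≡ pend i′ → i ≡ i′
pend-injective refl = refl

path⊆cycle : ∀ {n} {i k : Fin n} → PathAdj n i k → CycAdj n i k
path⊆cycle = Sum.map₂ inj₁

two-others : ∀ {m} → 3 ≤ m → (i : Fin m) → ∃₂ λ a b → a ≢ b × a ≢ i × b ≢ i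
two-others (s≤s (s≤s (s≤s _))) zero          = suc zero , suc (suc zero) , (λ ()) , (λ ()) , (λ ())
two-others (s≤s (s≤s (s≤s _))) (suc zero)    = zero , suc (suc zero) , (λ ()) , (λ ()) , (λ ())
two-others (s≤s (s≤s (s≤s _))) (suc (suc i)) = zero , suc zero , (λ ()) , (λ ()) , (λ ())

∀-or-∃¬ : ∀ {n} {P : Pred (Fin n) 0ℓ} → Decidable P → (∀ i → P i) ⊎ ∃ λ i → ¬ P i
∀-or-∃¬ {n} {P} P? with all? P?
... | yes ∀P = inj₁ ∀P
... | no ¬∀P = inj₂ (¬∀⟶∃¬ n P P? ¬∀P)

module Web (m r : ℕ) where

  _≟_ : DecidableEquality (WbV m r)
  grid i j ≟ grid i′ j′ = map′ (λ { (refl , refl) → refl }) grid-injective ((i ≟ᶠ i′) ×-dec (j ≟ᶠ j′))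
  grid _ _ ≟ pend _     = no λ ()
  pend _ ≟ grid _ _     = no λ ()
  pend i ≟ pend i′      = map′ (cong pend) pend-injective (i ≟ᶠ i′)

  open import Data.List.Membership.DecPropositional _≟_ using (_∈?_)

  path? : ∀ {n} → B.Decidable (PathAdj n)
  path? j j′ = (toℕ j′ ℕ.≟ suc (toℕ j)) ⊎-dec (toℕ j ℕ.≟ suc (toℕ j′))

  cycle? : ∀ {n} → B.Decidable (CycAdj n)
  cycle? {n} i i′ = (toℕ i′ ℕ.≟ suc (toℕ i)) ⊎-dec (toℕ i ℕ.≟ suc (toℕ i′))
             ⊎-dec ((toℕ i ℕ.≟ 0) ×-dec (toℕ i′ ℕ.≟ n ℕ.∸ 1))
             ⊎-dec ((toℕ i′ ℕ.≟ 0) ×-dec (toℕ i ℕ.≟ n ℕ.∸ 1))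

  adjacent? : B.Decidable (WbAdj m r)
  adjacent? (grid i j) (grid i′ j′) =
    map′ to from (((i ≟ᶠ i′) ×-dec path? j j′) ⊎-dec ((j ≟ᶠ j′) ×-dec cycle? i i′))
    where
    to : (i ≡ i′ × PathAdj r j j′) ⊎ (j ≡ j′ × CycAdj m i i′) → WbAdj m r (grid i j) (grid i′ j′)
    to (inj₁ (refl , j∼j′)) = along j∼j′
    to (inj₂ (refl , i∼i′)) = around i∼i′
    from : WbAdj m r (grid i j) (grid i′ j′) → (i ≡ i′ × PathAdj r j j′) ⊎ (j ≡ j′ × CycAdj m i i′)
    from (along j∼j′)  = inj₁ (refl , j∼j′)
    from (around i∼i′) = inj₂ (refl , i∼i′)
  adjacent? (grid i j) (pend i′) =
    map′ (λ { (refl , j≡0) → pendR j≡0 }) (λ { (pendR j≡0) → refl , j≡0 }) ((i ≟ᶠ i′) ×-dec (toℕ j ℕ.≟ 0))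
  adjacent? (pend i) (grid i′ j) =
    map′ (λ { (refl , j≡0) → pendL j≡0 }) (λ { (pendL j≡0) → refl , j≡0 }) ((i ≟ᶠ i′) ×-dec (toℕ j ℕ.≟ 0))
  adjacent? (pend _) (pend _) = no λ ()

  vertices : List (WbV m r)
  vertices = cartesianProductWith grid (allFin m) (allFin r) ++ map pend (allFin m)

  ∈-vertices : ∀ v → v ∈ vertices
  ∈-vertices (grid i j) = ∈-++⁺ˡ (∈-cartesianProductWith⁺ grid (∈-allFin i) (∈-allFin j))
  ∈-vertices (pend i)   = ∈-++⁺ʳ _ (∈-map⁺ pend (∈-allFin i))

  open ZeroForcing (Wb m r) _≟_ adjacent? vertices ∈-vertices

  pend-pendant : ∀ i → Pendant (pend i)
  pend-pendant i (pendR j≡0) (pendL j′≡0) = cong (grid i) (toℕ-injective (trans j≡0 (sym j′≡0)))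

  half-bound : ∀ {S} → ZeroForcingSet (Wb m r) S → Unique S → ⌈ m /2⌉ ≤ length S
  half-bound {S} zfs S-unique = begin
    ⌈ m /2⌉                    ≤⟨ ⌈n/2⌉-mono m≤2S ⟩
    ⌈ length S + length S /2⌉  ≡⟨ n≡⌈n+n/2⌉ (length S) ⟨
    length S                   ∎
    where
    open ≤-Reasoning
    pendants = map pend (allFin m)
    pendant : ∀ {v} → v ∈ pendants → Pendant v
    pendant v∈ = let i , _ , v≡pend-i = ∈-map⁻ pend v∈ in subst Pendant (sym v≡pend-i) (pend-pendant i)
    m≤2S : m ≤ length S + length S
    m≤2S = subst (_≤ length S + length S) (trans (length-map pend (allFin m)) (length-tabulate _))
                 (pendants-bound zfs S-unique (Unique.map⁺ pend-injective (Unique.allFin⁺ m)) pendant)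

  TwoInactive : List (WbV m r) → Fin r → Set
  TwoInactive U j = ∃₂ λ c₁ c₂ → c₁ ≢ c₂ × grid c₁ j ∉ U × grid c₂ j ∉ U

  two-inactive? : ∀ U → Decidable (TwoInactive U)
  two-inactive? U j =
    any? λ c₁ → any? λ c₂ → ¬? (c₁ ≟ᶠ c₂) ×-dec ¬? (grid c₁ j ∈? U) ×-dec ¬? (grid c₂ j ∈? U)

  HasActive : List (WbV m r) → Fin r → Set
  HasActive U j = ∃ λ i → grid i j ∈ U

  has-active? : ∀ U → Decidable (HasActive U)
  has-active? U j = any? λ i → grid i j ∈? U

  InactiveRing : List (WbV m r) → Fin r → Set
  InactiveRing U e = ∀ i → grid i e ∉ U

  -- The new forcer u lies in ring j, and if j = e then ring e keeps two inactive vertices since m ≥ 3.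
  inactive-ring-persists : 3 ≤ m → ∀ {U u j e} → TwoInactive U j → ¬ TwoInactive (u ∷ U) j →
                           InactiveRing U e → InactiveRing (u ∷ U) e
  inactive-ring-persists _ _ _ inactive i (there ie∈U) = inactive i ie∈U
  inactive-ring-persists m≥3 {U} {j = j} {e} (c₁ , c₂ , c₁≢c₂ , c₁∉U , c₂∉U) ¬two inactive i (here refl)
    with j ≟ᶠ e
  ... | no j≢e = ¬two (c₁ , c₂ , c₁≢c₂ , outside c₁∉U , outside c₂∉U)
    where
    outside : ∀ {c} → grid c j ∉ U → grid c j ∉ grid i e ∷ U
    outside _ (here cj≡ie) = j≢e (proj₂ (grid-injective cj≡ie))
    outside c∉U (there c∈U) = c∉U c∈U
  ... | yes refl = let a , b , a≢b , a≢i , b≢i = two-others m≥3 i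
                   in ¬two (a , b , a≢b , outside a≢i , outside b≢i)
    where
    outside : ∀ {c} → c ≢ i → grid c e ∉ grid i e ∷ U
    outside c≢i (here ce≡ie) = c≢i (proj₁ (grid-injective ce≡ie))
    outside _ (there c∈U) = inactive _ c∈U

  module _ {S : List (WbV m r)} (s : State S) where

    ring-boundary-idle : ∀ {j c} → Boundary (CycAdj m) (λ i → grid i j ∈ active s) c → Idle s (grid c j)
    ring-boundary-idle (c∉A , _ , i∈A , i∼c) = active-closed s i∈A (around i∼c) , c∉A

    column-boundary-idle : ∀ {i k} → Boundary (PathAdj r) (λ j → grid i j ∈ active s) k → Idle s (grid i k)
    column-boundary-idle (k∉A , _ , j∈A , j∼k) = active-closed s j∈A (along j∼k) , k∉A

    ring-idle-pair : ∀ {j} → HasActive (active s) j → TwoInactive (active s) j →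
                     ∃₂ λ c₁ c₂ → c₁ ≢ c₂ × Idle s (grid c₁ j) × Idle s (grid c₂ j)
    ring-idle-pair {j} (_ , x∈A) (_ , _ , c₁≢c₂ , c₁∉A , c₂∉A) =
      let b₁ , b₂ , b₁≢b₂ , bd₁ , bd₂ = cycle-boundaries (λ i → grid i j ∈? active s) x∈A c₁∉A c₂∉A c₁≢c₂
      in b₁ , b₂ , b₁≢b₂ , ring-boundary-idle bd₁ , ring-boundary-idle bd₂

    column-idle : 3 ≤ m → ∀ {j e} → ¬ TwoInactive (active s) j → InactiveRing (active s) e →
                  ∀ i → ∃ λ k → Idle s (grid i k)
    column-idle m≥3 {j} {e} ¬two inactive i with grid i j ∈? active s
    ... | yes ij∈A = let k , bd = path-boundary (λ k → grid i k ∈? active s) ij∈A (inactive i)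
                     in k , column-boundary-idle bd
    ... | no ij∉A = j , ring-boundary-idle i-boundary
      where
      others-active : ∀ {c} → c ≢ i → grid c j ∈ active s
      others-active {c} c≢i =
        decidable-stable (grid c j ∈? active s) λ cj∉A → ¬two (c , i , c≢i , cj∉A , ij∉A)
      i-boundary : Boundary (CycAdj m) (λ c → grid c j ∈ active s) i
      i-boundary with a , _ , _ , a≢i , _ ← two-others m≥3 i
                 with path-boundary (λ c → grid c j ∈? active s) (others-active a≢i) ij∉A
      ... | b , b∉A , f , f∈A , f∼b with b ≟ᶠ i
      ...   | yes refl = b∉A , f , f∈A , path⊆cycle f∼b
      ...   | no b≢i = contradiction (others-active b≢i) b∉A

    column-bound : (∀ i → ∃ λ k → Idle s (grid i k)) → m ≤ length S
    column-bound idle =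
      idle-family-bound s (λ i → grid i (proj₁ (idle i))) (proj₁ ∘ grid-injective) (proj₂ ∘ idle)

    ring-bound : (∀ j → ∃₂ λ c₁ c₂ → c₁ ≢ c₂ × Idle s (grid c₁ j) × Idle s (grid c₂ j)) →
                 2 * r ≤ length S
    ring-bound idle = subst (_≤ length S) length-L (idle-bound s L-unique L-idle)
      where
      first second : Fin r → WbV m r
      first j = grid (proj₁ (idle j)) j
      second j = grid (proj₁ (proj₂ (idle j))) j
      L = tabulate first ++ tabulate second
      length-L : length L ≡ 2 * r
      length-L = begin
        length L                                            ≡⟨ length-++ (tabulate first) ⟩
        length (tabulate first) + length (tabulate second)  ≡⟨ cong₂ _+_ (length-tabulate first)
                                                                             (length-tabulate second) ⟩
        r + r                                               ≡⟨ cong (r +_) (+-identityʳ r) ⟨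
        2 * r                                               ∎
        where open ≡-Reasoning
      disjoint : ∀ {v} → ¬ (v ∈ tabulate first × v ∈ tabulate second)
      disjoint (v∈₁ , v∈₂) with ∈-tabulate⁻ v∈₁ | ∈-tabulate⁻ v∈₂
      ... | j , refl | _ , first-j≡second-j′ with grid-injective first-j≡second-j′
      ...   | c₁≡c₂ , refl = let _ , _ , c₁≢c₂ , _ = idle j in c₁≢c₂ c₁≡c₂
      L-unique : Unique L
      L-unique = Unique.++⁺ (Unique.tabulate⁺ (proj₂ ∘ grid-injective))
                            (Unique.tabulate⁺ (proj₂ ∘ grid-injective)) disjoint
      L-idle : ∀ {v} → v ∈ L → Idle s v
      L-idle v∈L with ∈-++⁻ (tabulate first) v∈L
      ... | inj₁ v∈₁ = let j , v≡ = ∈-tabulate⁻ v∈₁ ; _ , _ , _ , idle₁ , _ = idle j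
                       in subst (Idle s) (sym v≡) idle₁
      ... | inj₂ v∈₂ = let j , v≡ = ∈-tabulate⁻ v∈₂ ; _ , _ , _ , _ , idle₂ = idle j
                       in subst (Idle s) (sym v≡) idle₂

  ring-or-column-bound : 3 ≤ m → 1 ≤ r → ∀ {S} → ZeroForcingSet (Wb m r) S → Unique S →
                         m ≤ length S ⊎ 2 * r ≤ length S
  ring-or-column-bound m≥3 r≥1 {S} zfs S-unique =
    forcing-induction zfs S-unique Invariant done advance initially
    where
    Bound = m ≤ length S ⊎ 2 * r ≤ length S

    Invariant : State S → Set
    Invariant s = (∀ j → TwoInactive (active s) j) × ∃ (InactiveRing (active s))

    initially : Invariant (start S-unique)
    initially = (λ _ → let a , b , a≢b , _ = two-others m≥3 (fromℕ< (≤-trans (s≤s z≤n) m≥3))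
                       in a , b , a≢b , (λ ()) , (λ ()))
              , fromℕ< r≥1 , λ _ ()

    done : ∀ s → Invariant s → (∀ v → v ∈ blue s) → Bound
    done s (_ , e , inactive) complete = inj₁ (column-bound s λ i → e , complete (grid i e) , inactive i)

    settle : ∀ s → (∀ {j} → ¬ TwoInactive (active s) j → ∃ (InactiveRing (active s))) →
             Invariant s ⊎ Bound
    settle s inactive-if-broken with ∀-or-∃¬ (two-inactive? (active s))
    ... | inj₂ (_ , ¬two) = let _ , inactive = inactive-if-broken ¬two
                            in inj₂ (inj₁ (column-bound s (column-idle s m≥3 ¬two inactive)))
    ... | inj₁ all-two with ∀-or-∃¬ (has-active? (active s))
    ...   | inj₁ all-have = inj₂ (inj₂ (ring-bound s λ j → ring-idle-pair s (all-have j) (all-two j)))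
    ...   | inj₂ (e , none) = inj₁ (all-two , e , λ i ie∈A → none (i , ie∈A))

    advance : ∀ s → Invariant s → (F : Force (blue s)) → Invariant (step s F) ⊎ Bound
    advance s (two , e , inactive) F =
      settle (step s F) λ ¬two → e , inactive-ring-persists m≥3 (two _) ¬two inactive

mainTheorem4 : (m r : ℕ) → 3 ≤ m → 1 ≤ r →
    ZAtLeast (Wb m r) (⌈ m /2⌉ ⊔ (m ⊓ (2 * r)))
mainTheorem4 m r m≥3 r≥1 S S-unique zfs =
  ⊔-lub (half-bound zfs S-unique)
        ([ ≤-trans (m⊓n≤m m (2 * r)) , ≤-trans (m⊓n≤n m (2 * r)) ]′
           (ring-or-column-bound m≥3 r≥1 zfs S-unique))
  where open Web m r
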